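{- Let $\langle A,\succ,1\rangle$ be a generalized $I$-algebra (G-algebra). Then for all $x,y,z\in A$: (G5) $x\succ x=1$; (G6) if $x\succ y=1$ and $y\succ x=1$, then $x=y$; (G7) $x\succ(y\succ x)=1$; (G8) $x\succ((x\succ y)\succ y)=1$; (G9) $x\succ(z\succ((x\succ y)\succ y))=1$; (G10) if $x\succ y=1$ and $y\succ z=1$, then $x\succ z=1$; (G11) the relation $\leq$ on $A$ defined by $x\leq y$ if and only if $x\succ y=1$ is a partial order on $A$; (G12) $x\leq (x\succ y)\succ y$; (G13) $y\leq (x\succ y)\succ y$; (G14) if $x\leq y$ then $y\succ z\leq x\succ z$; (G15) if $x\leq z$ and $y\leq z$ then $(x\succ y)\succ y\leq z$; (G16) $(A,\leq)$ is a join semilattice in which the supremum of $x,y$ is $x\vee y=(x\succ y)\succ y$.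
   Context: A generalized $I$-algebra (G-algebra) is an algebra $\langle A,\succ,1\rangle$ of type $(2,0)$ satisfying, for all $x,y,z\in A$: (G1) $1\succ x=x$; (G2) $x\succ 1=1$; (G3) $(x\succ y)\succ y=(y\succ x)\succ x$; (G4) if $x\succ(y\succ z)=1$ then $y\succ(x\succ z)=1$. -}

module Defs where

open import Level using (Level; suc)
open import Data.Product using (_×_)
open import Relation.Binary.PropositionalEquality using (_≡_)
open import Relation.Binary.Structures using (IsPartialOrder)
open import Relation.Binary.Lattice.Structures using (IsJoinSemilattice)

record IsGAlgebra {a : Level} (A : Set a) (_≻_ : A → A → A) (𝟏 : A) : Set a where
  field
    G1 : ∀ x → 𝟏 ≻ x ≡ x
    G2 : ∀ x → x ≻ 𝟏 ≡ 𝟏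
    G3 : ∀ x y → (x ≻ y) ≻ y ≡ (y ≻ x) ≻ x
    G4 : ∀ x y z → x ≻ (y ≻ z) ≡ 𝟏 → y ≻ (x ≻ z) ≡ 𝟏

_≤[_,_]_ : {a : Level} {A : Set a} → A → (A → A → A) → A → A → Set a
x ≤[ _≻_ , 𝟏 ] y = x ≻ y ≡ 𝟏

record G5-G16 {a : Level} (A : Set a) (_≻_ : A → A → A) (𝟏 : A) : Set a where
  _≤_ : A → A → Set a
  x ≤ y = x ≤[ _≻_ , 𝟏 ] y
  field
    G5  : ∀ x → x ≻ x ≡ 𝟏
    G6  : ∀ x y → x ≻ y ≡ 𝟏 → y ≻ x ≡ 𝟏 → x ≡ y
    G7  : ∀ x y → x ≻ (y ≻ x) ≡ 𝟏
    G8  : ∀ x y → x ≻ ((x ≻ y) ≻ y) ≡ 𝟏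
    G9  : ∀ x y z → x ≻ (z ≻ ((x ≻ y) ≻ y)) ≡ 𝟏
    G10 : ∀ x y z → x ≻ y ≡ 𝟏 → y ≻ z ≡ 𝟏 → x ≻ z ≡ 𝟏
    G11 : IsPartialOrder _≡_ _≤_
    G12 : ∀ x y → x ≤ ((x ≻ y) ≻ y)
    G13 : ∀ x y → y ≤ ((x ≻ y) ≻ y)
    G14 : ∀ x y z → x ≤ y → (y ≻ z) ≤ (x ≻ z)
    G15 : ∀ x y z → x ≤ z → y ≤ z → ((x ≻ y) ≻ y) ≤ z
    G16 : IsJoinSemilattice _≡_ _≤_ (λ x y → (x ≻ y) ≻ y)

-- Writing x ≤ y for x ≻ y = 1, the exchange law G4 reads: x ≤ y ≻ z implies
-- y ≤ x ≻ z. Together with 1 ≻ x = x and x ≻ 1 = 1 this makes ≤ reflexive and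
-- ≻ antitone in its first argument, whence transitivity. Antisymmetry and the
-- join come from G3: the element x ∨ y = (x ≻ y) ≻ y is symmetric in x, y,
-- collapses to y when x ≤ y, and is below every common upper bound by
-- applying antitonicity twice.
module Submission where

open import Level using (Level)
open import Defs
open import Data.Product using (_,_)
open import Relation.Binary.PropositionalEquality
open import Relation.Binary.Structures using (IsPartialOrder)
open import Relation.Binary.Lattice.Structures using (IsJoinSemilattice)

module GAlgebraProperties {a : Level} {A : Set a} {_≻_ : A → A → A} {𝟏 : A}
                          (G : IsGAlgebra A _≻_ 𝟏) where
  open IsGAlgebra G

  infix 4 _≤_
  _≤_ : A → A → Set a
  x ≤ y = x ≤[ _≻_ , 𝟏 ] y

  infixr 6 _∨_
  _∨_ : A → A → A
  x ∨ y = (x ≻ y) ≻ y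

  ≤-refl : ∀ x → x ≤ x
  ≤-refl x = begin
    x ≻ x             ≡⟨ cong (_≻ x) (sym (G1 x)) ⟩
    (𝟏 ≻ x) ≻ x       ≡⟨ sym (G3 x 𝟏) ⟩
    (x ≻ 𝟏) ≻ 𝟏       ≡⟨ G2 (x ≻ 𝟏) ⟩
    𝟏                 ∎
    where open ≡-Reasoning

  ∨-comm : ∀ x y → x ∨ y ≡ y ∨ x
  ∨-comm = G3

  ∨-of-≤ : ∀ {x y} → x ≤ y → x ∨ y ≡ y
  ∨-of-≤ {x} {y} x≤y = trans (cong (_≻ y) x≤y) (G1 y)

  ≤-antisym : ∀ {x y} → x ≤ y → y ≤ x → x ≡ y
  ≤-antisym {x} {y} x≤y y≤x = begin
    x       ≡⟨ sym (∨-of-≤ y≤x) ⟩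
    y ∨ x   ≡⟨ ∨-comm y x ⟩
    x ∨ y   ≡⟨ ∨-of-≤ x≤y ⟩
    y       ∎
    where open ≡-Reasoning

  ≤-≻-exchange : ∀ {x y z} → x ≤ y ≻ z → y ≤ x ≻ z
  ≤-≻-exchange = G4 _ _ _

  ≤-≻-of-≤ : ∀ x {y z} → y ≤ z → y ≤ x ≻ z
  ≤-≻-of-≤ x {y} {z} y≤z = ≤-≻-exchange (trans (cong (x ≻_) y≤z) (G2 x))

  ≤-≻-self : ∀ x y → x ≤ y ≻ x
  ≤-≻-self x y = ≤-≻-of-≤ y (≤-refl x)

  ≤-∨ʳ : ∀ x y → y ≤ x ∨ y
  ≤-∨ʳ x y = ≤-≻-self y (x ≻ y)

  ≤-∨ˡ : ∀ x y → x ≤ x ∨ y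
  ≤-∨ˡ x y = ≤-≻-exchange (≤-refl (x ≻ y))

  ≻-antitoneˡ : ∀ {x y} z → x ≤ y → y ≻ z ≤ x ≻ z
  ≻-antitoneˡ {x} {y} z x≤y =
    ≤-≻-exchange (subst (x ≤_) (∨-comm z y) (≤-≻-of-≤ (z ≻ y) x≤y))

  ≤-trans : ∀ {x y z} → x ≤ y → y ≤ z → x ≤ z
  ≤-trans {x} {y} {z} x≤y y≤z = begin
    x ≻ z               ≡⟨ sym (G1 (x ≻ z)) ⟩
    𝟏 ≻ (x ≻ z)         ≡⟨ cong (_≻ (x ≻ z)) (sym y≤z) ⟩
    (y ≻ z) ≻ (x ≻ z)   ≡⟨ ≻-antitoneˡ z x≤y ⟩
    𝟏                   ∎
    where open ≡-Reasoning

  ∨-least : ∀ {x y z} → x ≤ z → y ≤ z → x ∨ y ≤ z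
  ∨-least {x} {y} {z} x≤z y≤z =
    subst (x ∨ y ≤_) (trans (∨-comm z y) (∨-of-≤ y≤z))
      (≻-antitoneˡ y (≻-antitoneˡ y x≤z))

  ≤-isPartialOrder : IsPartialOrder _≡_ _≤_
  ≤-isPartialOrder = record
    { isPreorder = record
      { isEquivalence = isEquivalence
      ; reflexive     = λ { {x} refl → ≤-refl x }
      ; trans         = ≤-trans
      }
    ; antisym = ≤-antisym
    }

  ∨-isJoinSemilattice : IsJoinSemilattice _≡_ _≤_ _∨_
  ∨-isJoinSemilattice = record
    { isPartialOrder = ≤-isPartialOrder
    ; supremum       = λ x y → ≤-∨ˡ x y , ≤-∨ʳ x y , λ z → ∨-least
    }

lemma2p3 : {a : Level} (A : Set a) (_≻_ : A → A → A) (𝟏 : A) →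
    IsGAlgebra A _≻_ 𝟏 → G5-G16 A _≻_ 𝟏
lemma2p3 A _≻_ 𝟏 G = record
  { G5  = ≤-refl
  ; G6  = λ _ _ → ≤-antisym
  ; G7  = ≤-≻-self
  ; G8  = ≤-∨ˡ
  ; G9  = λ x y z → ≤-≻-of-≤ z (≤-∨ˡ x y)
  ; G10 = λ _ _ _ → ≤-trans
  ; G11 = ≤-isPartialOrder
  ; G12 = ≤-∨ˡ
  ; G13 = ≤-∨ʳ
  ; G14 = λ _ _ z → ≻-antitoneˡ z
  ; G15 = λ _ _ _ → ∨-least
  ; G16 = ∨-isJoinSemilattice
  }
  where open GAlgebraProperties G
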